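{- Let $S = 0100010101000100\cdots$ be the period-doubling word, the fixed point of the morphism $\sigma$ on $\{0,1\}$ defined by $\sigma(0) = 01$, $\sigma(1) = 00$. Then $\overline{\mathcal P}^{(1)}_S(n) = \Theta(\log n)$ as $n \to \infty$, and $\underline{\mathcal P}^{(1)}_S(n) = 2$ for all $n \geq 1$.
   Context: Two finite words are Abelian equivalent if each letter occurs the same number of times in both. For an infinite word $w$, $\mathcal P^{(1)}_w(n)$ (the Abelian complexity) is the number of Abelian equivalence classes among the factors of $w$ of length $n$. The upper and lower Abelian complexities are $\overline{\mathcal P}^{(1)}_w(n) = \max_{1 \le m \leq n} \mathcal P^{(1)}_w(m)$ and $\underline{\mathcal P}^{(1)}_w(n) = \min_{m \geq n} \mathcal P^{(1)}_w(m)$. -}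

module Defs where

open import Data.Nat using (ℕ; zero; suc; _+_; _*_; _≤_)
open import Data.Fin using (Fin)
import Data.Fin
import Relation.Nullary
open import Data.List using (List; []; _∷_; _++_; concatMap; length)
open import Data.Product using (Σ; ∃; _×_; _,_)
open import Function.Bundles using (_⇔_)
open import Relation.Binary.PropositionalEquality using (_≡_)
open import Data.List.Membership.Propositional using (_∈_)
open import Data.List.Relation.Unary.Unique.Propositional using (Unique)

Letter : Set
Letter = Fin 2

pattern a0 = Fin.zero
pattern a1 = Fin.suc Fin.zero

Word : Set
Word = ℕ → Letter

σ : Letter → List Letter
σ a0 = a0 ∷ a1 ∷ []
σ a1 = a0 ∷ a0 ∷ []

σ* : List Letter → List Letter
σ* = concatMap σ

iterσ : ℕ → List Letter
iterσ zero = a0 ∷ []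
iterσ (suc k) = σ* (iterσ k)

-- i-th letter of a list (default 0 when out of range; never used here,
-- since σ^(i+1)(0) has length 2^(i+1) > i)
nth : List Letter → ℕ → Letter
nth [] _ = a0
nth (x ∷ xs) zero = x
nth (x ∷ xs) (suc i) = nth xs i

-- The period-doubling word S = lim σ^k(0) (fixed point of σ starting with 0):
-- S(i) is the i-th letter of the prefix σ^(i+1)(0).
S : Word
S i = nth (iterσ (suc i)) i

count : Word → Letter → ℕ → ℕ → ℕ
count w a i zero = 0
count w a i (suc n) with w i Data.Fin.≟ a
... | Relation.Nullary.yes _ = suc (count w a (suc i) n)
... | Relation.Nullary.no _ = count w a (suc i) n

parikh : Word → ℕ → ℕ → ℕ × ℕ
parikh w i n = count w a0 i n , count w a1 i n

-- AbCx w n k : the Abelian complexity P^(1)_w(n) equals k, i.e. the number of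
-- Abelian equivalence classes (= distinct Parikh vectors) of length-n factors is k.
AbCx : Word → ℕ → ℕ → Set
AbCx w n k =
  Σ (List (ℕ × ℕ)) λ L →
    Unique L × length L ≡ k × (∀ p → (p ∈ L) ⇔ (∃ λ i → parikh w i n ≡ p))

UpperAbCx : Word → ℕ → ℕ → Set
UpperAbCx w n k =
  (∀ m j → 1 ≤ m → m ≤ n → AbCx w m j → j ≤ k)
  × (∃ λ m → 1 ≤ m × m ≤ n × AbCx w m k)

LowerAbCx : Word → ℕ → ℕ → Set
LowerAbCx w n k =
  (∀ m j → n ≤ m → AbCx w m j → k ≤ j)
  × (∃ λ m → n ≤ m × AbCx w m k)

-- Let ones i n count the 1s in the factor S[i, i+n). Since S (2j) = 0 and S (2j+1) = 1 − S j,
-- a factor of length m starting at 2i contains ⌊m/2⌋ − ones i ⌊m/2⌋ ones, and one starting at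
-- 2i+1 contains ⌈m/2⌉ − ones i ⌈m/2⌉. So the extreme counts lo m ≤ ones i m ≤ hi m obey
-- lo m = ⌊m/2⌋ − hi ⌊m/2⌋ and hi m = ⌈m/2⌉ − lo ⌈m/2⌉. Sliding the window changes the count by
-- at most one, so every value in between occurs and P(m) = width m + 1, width m = hi m − lo m.
-- The recursion gives width (2n) = width n and width (2n+1) ∈ {width n, width n + 1}, the larger
-- value exactly when lo (n+1) = lo n. Hence width 2^k = 1 and 1 ≤ width n ≤ ⌊log₂ n⌋ + 1, while
-- width ((4^k − 1)/3) = k because lo (2r+1) = lo (2r) always.

module Submission where

open import Defs
open import Data.Nat using (ℕ; _*_; _≤_)
open import Data.Nat.Logarithm using (⌊log₂_⌋)
open import Data.Product using (∃; _×_)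
open import Data.Nat using (zero; suc; _+_; _∸_; _^_; _<_; z≤n; s≤s; _⊔_; _≤?_; _<?_; ⌊_/2⌋; ⌈_/2⌉)
open import Data.Nat.Properties
open import Data.Nat.Logarithm using (⌊log₂⌋-mono-≤; ⌊log₂[2^n]⌋≡n)
open import Data.Nat.Induction using (<-rec)
open import Data.Product using (∃₂; _,_; proj₁; proj₂)
open import Data.Sum using (_⊎_; inj₁; inj₂)
open import Data.Empty using (⊥-elim)
import Data.Fin
open import Data.List using ([]; _∷_; _++_; length; applyUpTo)
open import Data.List.Properties using (concatMap-++; length-applyUpTo)
open import Data.List.Membership.Propositional using (_∈_)
open import Data.List.Membership.Propositional.Properties using (∈-applyUpTo⁺; ∈-applyUpTo⁻)
open import Data.List.Membership.Propositional.Properties.WithK using (unique∧set⇒bag)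
open import Data.List.Relation.Unary.Unique.Propositional.Properties using (applyUpTo⁺₁)
open import Data.List.Relation.Binary.BagAndSetEquality using (∼bag⇒↭)
open import Data.List.Relation.Binary.Permutation.Propositional.Properties using (↭-length)
open import Function.Bundles using (mk⇔)
open import Function.Properties.Equivalence using () renaming (trans to ⇔-trans; sym to ⇔-sym)
open import Relation.Binary.PropositionalEquality using (_≡_; _≢_; refl; sym; trans; cong; cong₂; subst; module ≡-Reasoning)
open import Relation.Nullary using (yes; no; ¬_)
open import Algebra.Properties.CommutativeSemigroup +-commutativeSemigroup using (interchange)

double : ℕ → ℕ
double zero = zero
double (suc n) = suc (suc (double n))

double≡2* : ∀ n → double n ≡ 2 * n
double≡2* zero = refl
double≡2* (suc n) = cong suc (trans (cong suc (double≡2* n)) (sym (+-suc n (n + 0))))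

2^suc≡double : ∀ n → 2 ^ suc n ≡ double (2 ^ n)
2^suc≡double n = sym (double≡2* (2 ^ n))

n<2^n : ∀ n → n < 2 ^ n
n<2^n zero = s≤s z≤n
n<2^n (suc n) = +-mono-≤ (m^n>0 2 n) (≤-trans (n<2^n n) (m≤m+n (2 ^ n) 0))

n≤double : ∀ n → n ≤ double n
n≤double n = subst (n ≤_) (sym (double≡2* n)) (m≤m+n n (n + 0))

double-cancel-< : ∀ {m n} → double m < double n → m < n
double-cancel-< {zero} {suc n} _ = s≤s z≤n
double-cancel-< {suc m} {suc n} (s≤s (s≤s lt)) = s≤s (double-cancel-< lt)

⌊double[n]/2⌋≡n : ∀ n → ⌊ double n /2⌋ ≡ n
⌊double[n]/2⌋≡n zero = refl
⌊double[n]/2⌋≡n (suc n) = cong suc (⌊double[n]/2⌋≡n n)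

⌈double[n]/2⌉≡n : ∀ n → ⌈ double n /2⌉ ≡ n
⌈double[n]/2⌉≡n zero = refl
⌈double[n]/2⌉≡n (suc n) = cong suc (⌈double[n]/2⌉≡n n)

⌈n/2⌉≡⌊n/2⌋∨1+⌊n/2⌋ : ∀ n → ⌈ n /2⌉ ≡ ⌊ n /2⌋ ⊎ ⌈ n /2⌉ ≡ suc ⌊ n /2⌋
⌈n/2⌉≡⌊n/2⌋∨1+⌊n/2⌋ zero = inj₁ refl
⌈n/2⌉≡⌊n/2⌋∨1+⌊n/2⌋ (suc zero) = inj₂ refl
⌈n/2⌉≡⌊n/2⌋∨1+⌊n/2⌋ (suc (suc n)) with ⌈n/2⌉≡⌊n/2⌋∨1+⌊n/2⌋ n
... | inj₁ eq = inj₁ (cong suc eq)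
... | inj₂ eq = inj₂ (cong suc eq)

data Halving : ℕ → Set where
  even : ∀ n → Halving (double n)
  odd : ∀ n → Halving (suc (double n))

halving : ∀ n → Halving n
halving zero = even zero
halving (suc n) with halving n
... | even m = odd m
... | odd m = even (suc m)

m+n≡o⇒m≡o∸n : ∀ {m n o} → m + n ≡ o → m ≡ o ∸ n
m+n≡o⇒m≡o∸n {m} {n} refl = sym (m+n∸n≡m m n)

[m∸a]∸[m∸b]≡b∸a : ∀ {m a b} → a ≤ b → b ≤ m → (m ∸ a) ∸ (m ∸ b) ≡ b ∸ a
[m∸a]∸[m∸b]≡b∸a {m} {a} {b} a≤b b≤m = begin
  (m ∸ a) ∸ (m ∸ b)                 ≡⟨ cong (λ k → k ∸ a ∸ (m ∸ b)) (m∸n+n≡m b≤m) ⟨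
  ((m ∸ b) + b) ∸ a ∸ (m ∸ b)       ≡⟨ cong (_∸ (m ∸ b)) (+-∸-assoc (m ∸ b) a≤b) ⟩
  ((m ∸ b) + (b ∸ a)) ∸ (m ∸ b)     ≡⟨ m+n∸m≡n (m ∸ b) (b ∸ a) ⟩
  b ∸ a                             ∎
  where open ≡-Reasoning

2^k≤n⇒k≤⌊log₂n⌋ : ∀ {n k} → 2 ^ k ≤ n → k ≤ ⌊log₂ n ⌋
2^k≤n⇒k≤⌊log₂n⌋ {n} {k} 2^k≤n = subst (_≤ ⌊log₂ n ⌋) (⌊log₂[2^n]⌋≡n k) (⌊log₂⌋-mono-≤ 2^k≤n)

n≤2^k⇒⌊log₂n⌋≤k : ∀ {n k} → n ≤ 2 ^ k → ⌊log₂ n ⌋ ≤ k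
n≤2^k⇒⌊log₂n⌋≤k {n} {k} n≤2^k = subst (⌊log₂ n ⌋ ≤_) (⌊log₂[2^n]⌋≡n k) (⌊log₂⌋-mono-≤ n≤2^k)

n<2^suc⌊log₂n⌋ : ∀ n → n < 2 ^ suc ⌊log₂ n ⌋
n<2^suc⌊log₂n⌋ n with 2 ^ suc ⌊log₂ n ⌋ ≤? n
... | yes 2^≤n = ⊥-elim (1+n≰n (2^k≤n⇒k≤⌊log₂n⌋ 2^≤n))
... | no 2^≰n = ≰⇒> 2^≰n

2+n≤3*n : ∀ {n} → 1 ≤ n → 2 + n ≤ 3 * n
2+n≤3*n {suc n} _ = subst (3 + n ≤_) (sym (*-suc 3 n)) (+-monoʳ-≤ 3 (m≤n*m n 3))

bracket : ∀ {f : ℕ → ℕ} → f 0 ≡ 0 → (∀ k → f k < f (suc k)) → ∀ n → ∃ λ k → f k ≤ n × n < f (suc k)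
bracket {f} f0≡0 increasing zero = 0 , ≤-reflexive f0≡0 , subst (_< f 1) f0≡0 (increasing 0)
bracket {f} f0≡0 increasing (suc n) with bracket f0≡0 increasing n
... | k , fk≤n , n<fk+1 with suc n <? f (suc k)
...   | yes n+1<fk+1 = k , ≤-trans fk≤n (n≤1+n n) , n+1<fk+1
...   | no n+1≮fk+1 = suc k , ≤-reflexive (sym n+1≡fk+1) , subst (_< f (suc (suc k))) (sym n+1≡fk+1) (increasing (suc k))
  where
  n+1≡fk+1 : suc n ≡ f (suc k)
  n+1≡fk+1 = ≤-antisym n<fk+1 (≮⇒≥ n+1≮fk+1)


-- The letters of S

complement : Letter → Letter
complement a0 = a1
complement a1 = a0

length-σ* : ∀ xs → length (σ* xs) ≡ double (length xs)
length-σ* [] = refl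
length-σ* (a0 ∷ xs) = cong (λ n → suc (suc n)) (length-σ* xs)
length-σ* (a1 ∷ xs) = cong (λ n → suc (suc n)) (length-σ* xs)

length-iterσ : ∀ k → length (iterσ k) ≡ 2 ^ k
length-iterσ zero = refl
length-iterσ (suc k) = trans (length-σ* (iterσ k)) (trans (cong double (length-iterσ k)) (sym (2^suc≡double k)))

nth-σ*-double : ∀ xs j → nth (σ* xs) (double j) ≡ a0
nth-σ*-double [] j = refl
nth-σ*-double (a0 ∷ xs) zero = refl
nth-σ*-double (a1 ∷ xs) zero = refl
nth-σ*-double (a0 ∷ xs) (suc j) = nth-σ*-double xs j
nth-σ*-double (a1 ∷ xs) (suc j) = nth-σ*-double xs j

nth-σ*-suc-double : ∀ xs {j} → j < length xs → nth (σ* xs) (suc (double j)) ≡ complement (nth xs j)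
nth-σ*-suc-double (a0 ∷ xs) {zero} _ = refl
nth-σ*-suc-double (a1 ∷ xs) {zero} _ = refl
nth-σ*-suc-double (a0 ∷ xs) {suc j} (s≤s lt) = nth-σ*-suc-double xs lt
nth-σ*-suc-double (a1 ∷ xs) {suc j} (s≤s lt) = nth-σ*-suc-double xs lt

nth-++ˡ : ∀ xs ys {i} → i < length xs → nth (xs ++ ys) i ≡ nth xs i
nth-++ˡ (x ∷ xs) ys {zero} _ = refl
nth-++ˡ (x ∷ xs) ys {suc i} (s≤s lt) = nth-++ˡ xs ys lt

iterσ-suc-extends : ∀ k → ∃ λ ys → iterσ (suc k) ≡ iterσ k ++ ys
iterσ-suc-extends zero = a1 ∷ [] , refl
iterσ-suc-extends (suc k) with iterσ-suc-extends k
... | ys , eq = σ* ys , trans (cong σ* eq) (concatMap-++ σ (iterσ k) ys)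

nth-iterσ-stable : ∀ d k {i} → i < 2 ^ k → nth (iterσ (d + k)) i ≡ nth (iterσ k) i
nth-iterσ-stable zero k lt = refl
nth-iterσ-stable (suc d) k {i} lt with iterσ-suc-extends (d + k)
... | ys , eq = begin
  nth (iterσ (suc d + k)) i        ≡⟨ cong (λ xs → nth xs i) eq ⟩
  nth (iterσ (d + k) ++ ys) i      ≡⟨ nth-++ˡ (iterσ (d + k)) ys i<length ⟩
  nth (iterσ (d + k)) i            ≡⟨ nth-iterσ-stable d k lt ⟩
  nth (iterσ k) i                  ∎
  where
  open ≡-Reasoning
  i<length : i < length (iterσ (d + k))
  i<length = subst (i <_) (sym (length-iterσ (d + k))) (≤-trans lt (^-monoʳ-≤ 2 (m≤n+m k d)))

S≡nth-iterσ : ∀ k {i} → i < 2 ^ k → S i ≡ nth (iterσ k) i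
S≡nth-iterσ k {i} lt = begin
  nth (iterσ (suc i)) i        ≡⟨ nth-iterσ-stable k (suc i) (<-trans (n<1+n i) (n<2^n (suc i))) ⟨
  nth (iterσ (k + suc i)) i    ≡⟨ cong (λ e → nth (iterσ e) i) (+-comm k (suc i)) ⟩
  nth (iterσ (suc i + k)) i    ≡⟨ nth-iterσ-stable (suc i) k lt ⟩
  nth (iterσ k) i              ∎
  where open ≡-Reasoning

S-double : ∀ j → S (double j) ≡ a0
S-double j = nth-σ*-double (iterσ (double j)) j

S-suc-double : ∀ j → S (suc (double j)) ≡ complement (S j)
S-suc-double j = begin
  nth (σ* (iterσ (suc (double j)))) (suc (double j))   ≡⟨ nth-σ*-suc-double (iterσ (suc (double j))) j<length ⟩
  complement (nth (iterσ (suc (double j))) j)          ≡⟨ cong complement (S≡nth-iterσ (suc (double j)) j<2^) ⟨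
  complement (S j)                                     ∎
  where
  open ≡-Reasoning
  j<2^ : j < 2 ^ suc (double j)
  j<2^ = ≤-trans (n<2^n j) (^-monoʳ-≤ 2 (≤-trans (n≤double j) (n≤1+n _)))
  j<length : j < length (iterσ (suc (double j)))
  j<length = subst (j <_) (sym (length-iterσ (suc (double j)))) j<2^


-- Counting ones in factors of a binary word

bit : Letter → ℕ
bit a0 = 0
bit a1 = 1

bit≤1 : ∀ x → bit x ≤ 1
bit≤1 a0 = z≤n
bit≤1 a1 = s≤s z≤n

bit-complement : ∀ x → bit (complement x) + bit x ≡ 1
bit-complement a0 = refl
bit-complement a1 = refl

bit≡0 : ∀ {x} → ¬ x ≡ a1 → bit x ≡ 0
bit≡0 {a0} _ = refl
bit≡0 {a1} x≢a1 = ⊥-elim (x≢a1 refl)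

bit≡1 : ∀ {x} → ¬ x ≡ a0 → bit x ≡ 1
bit≡1 {a0} x≢a0 = ⊥-elim (x≢a0 refl)
bit≡1 {a1} _ = refl

ones : Word → ℕ → ℕ → ℕ
ones w i zero = 0
ones w i (suc n) = bit (w i) + ones w (suc i) n

count-a1≡ones : ∀ w i n → count w a1 i n ≡ ones w i n
count-a1≡ones w i zero = refl
count-a1≡ones w i (suc n) with w i Data.Fin.≟ a1
... | yes wi≡a1 rewrite wi≡a1 = cong suc (count-a1≡ones w (suc i) n)
... | no wi≢a1 rewrite bit≡0 wi≢a1 = count-a1≡ones w (suc i) n

count-a0+ones≡length : ∀ w i n → count w a0 i n + ones w i n ≡ n
count-a0+ones≡length w i zero = refl
count-a0+ones≡length w i (suc n) with w i Data.Fin.≟ a0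
... | yes wi≡a0 rewrite wi≡a0 = cong suc (count-a0+ones≡length w (suc i) n)
... | no wi≢a0 rewrite bit≡1 wi≢a0 = trans (+-suc _ _) (cong suc (count-a0+ones≡length w (suc i) n))

parikh≡ : ∀ w i n → parikh w i n ≡ (n ∸ ones w i n , ones w i n)
parikh≡ w i n = cong₂ _,_ (m+n≡o⇒m≡o∸n (count-a0+ones≡length w i n)) (count-a1≡ones w i n)

ones≤length : ∀ w i n → ones w i n ≤ n
ones≤length w i zero = z≤n
ones≤length w i (suc n) = +-mono-≤ (bit≤1 (w i)) (ones≤length w (suc i) n)

ones-mono-length : ∀ w i n → ones w i n ≤ ones w i (suc n)
ones-mono-length w i zero = z≤n
ones-mono-length w i (suc n) = +-monoʳ-≤ (bit (w i)) (ones-mono-length w (suc i) n)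

ones-suc-length≤ : ∀ w i n → ones w i (suc n) ≤ suc (ones w i n)
ones-suc-length≤ w i zero = ≤-trans (≤-reflexive (+-identityʳ _)) (bit≤1 (w i))
ones-suc-length≤ w i (suc n) = begin
  bit (w i) + ones w (suc i) (suc n)   ≤⟨ +-monoʳ-≤ (bit (w i)) (ones-suc-length≤ w (suc i) n) ⟩
  bit (w i) + suc (ones w (suc i) n)   ≡⟨ +-suc (bit (w i)) _ ⟩
  suc (ones w i (suc n))               ∎
  where open ≤-Reasoning

ones-suc-start≤ : ∀ w i n → ones w (suc i) n ≤ suc (ones w i n)
ones-suc-start≤ w i n = ≤-trans (m≤n+m _ (bit (w i))) (ones-suc-length≤ w i n)

ones≤suc-start : ∀ w i n → ones w i n ≤ suc (ones w (suc i) n)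
ones≤suc-start w i n = ≤-trans (ones-mono-length w i n) (+-monoˡ-≤ _ (bit≤1 (w i)))


-- Extreme values of functions ℕ → ℕ

record MinMax (f : ℕ → ℕ) (l u : ℕ) : Set where
  field
    lower : ∀ i → l ≤ f i
    upper : ∀ i → f i ≤ u
    lower-attained : ∃ λ i → f i ≡ l
    upper-attained : ∃ λ i → f i ≡ u

open MinMax

module _ {f : ℕ → ℕ} where

  MinMax-unique : ∀ {l u l′ u′} → MinMax f l u → MinMax f l′ u′ → l ≡ l′ × u ≡ u′
  MinMax-unique R R′ with lower-attained R | upper-attained R | lower-attained R′ | upper-attained R′
  ... | i , refl | j , refl | i′ , refl | j′ , refl =
    ≤-antisym (lower R i′) (lower R′ i) , ≤-antisym (upper R′ j) (upper R j′)

  MinMax-lower≤upper : ∀ {l u} → MinMax f l u → l ≤ u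
  MinMax-lower≤upper R = ≤-trans (lower R 0) (upper R 0)

  MinMax-∸ : ∀ a {l u} → MinMax f l u → MinMax (λ i → a ∸ f i) (a ∸ u) (a ∸ l)
  MinMax-∸ a R = record
    { lower = λ i → ∸-monoʳ-≤ a (upper R i)
    ; upper = λ i → ∸-monoʳ-≤ a (lower R i)
    ; lower-attained = let i , eq = upper-attained R in i , cong (a ∸_) eq
    ; upper-attained = let i , eq = lower-attained R in i , cong (a ∸_) eq
    }

  MinMax-cong : ∀ {g l u} → (∀ i → f i ≡ g i) → MinMax f l u → MinMax g l u
  MinMax-cong f≗g R = record
    { lower = λ i → subst (_ ≤_) (f≗g i) (lower R i)
    ; upper = λ i → subst (_≤ _) (f≗g i) (upper R i)
    ; lower-attained = let i , eq = lower-attained R in i , trans (sym (f≗g i)) eq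
    ; upper-attained = let i , eq = upper-attained R in i , trans (sym (f≗g i)) eq
    }

  MinMax-≤-+ : ∀ {g l u l′ u′} c → (∀ i → g i ≤ c + f i) → MinMax f l u → MinMax g l′ u′ →
               l′ ≤ c + l × u′ ≤ c + u
  MinMax-≤-+ c g≤c+f R R′ with lower-attained R | upper-attained R′
  ... | i , refl | j , refl = ≤-trans (lower R′ i) (g≤c+f i) , ≤-trans (g≤c+f j) (+-monoʳ-≤ c (upper R j))

  MinMax-interleave : ∀ {l₁ u₁ l₂ u₂} →
                      MinMax (λ i → f (double i)) l₁ u₁ → MinMax (λ i → f (suc (double i))) l₂ u₂ →
                      l₁ ≤ l₂ → u₁ ≤ u₂ → MinMax f l₁ u₂
  MinMax-interleave E O l₁≤l₂ u₁≤u₂ = record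
    { lower = lower′
    ; upper = upper′
    ; lower-attained = let i , eq = lower-attained E in double i , eq
    ; upper-attained = let i , eq = upper-attained O in suc (double i) , eq
    }
    where
    lower′ : ∀ i → _ ≤ f i
    lower′ i with halving i
    ... | even j = lower E j
    ... | odd j = ≤-trans l₁≤l₂ (lower O j)
    upper′ : ∀ i → f i ≤ _
    upper′ i with halving i
    ... | even j = ≤-trans (upper E j) u₁≤u₂
    ... | odd j = upper O j

module _ {f : ℕ → ℕ} (step-up : ∀ i → f (suc i) ≤ suc (f i)) (step-down : ∀ i → f i ≤ suc (f (suc i))) where

  private
    rising : ∀ a d {v} → f a ≤ v → v ≤ f (d + a) → ∃ λ i → f i ≡ v
    rising a zero fa≤v v≤fa = a , ≤-antisym fa≤v v≤fa
    rising a (suc d) {v} fa≤v v≤f with v ≤? f (d + a)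
    ... | yes v≤f′ = rising a d fa≤v v≤f′
    ... | no v≰f′ = suc (d + a) , ≤-antisym (≤-trans (step-up (d + a)) (≰⇒> v≰f′)) v≤f

    falling : ∀ a d {v} → f (d + a) ≤ v → v ≤ f a → ∃ λ i → f i ≡ v
    falling a zero fa≤v v≤fa = a , ≤-antisym fa≤v v≤fa
    falling a (suc d) {v} f≤v v≤fa with f (d + a) ≤? v
    ... | yes f′≤v = falling a d f′≤v v≤fa
    ... | no f′≰v = suc (d + a) , ≤-antisym f≤v (≤-pred (≤-trans (≰⇒> f′≰v) (step-down (d + a))))

  intermediate-value : ∀ {i j v} → f i ≤ v → v ≤ f j → ∃ λ k → f k ≡ v
  intermediate-value {i} {j} fi≤v v≤fj with ≤-total i j
  ... | inj₁ i≤j = rising i (j ∸ i) fi≤v (subst (λ k → _ ≤ f k) (sym (m∸n+n≡m i≤j)) v≤fj)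
  ... | inj₂ j≤i = falling j (i ∸ j) (subst (λ k → f k ≤ _) (sym (m∸n+n≡m j≤i)) fi≤v) v≤fj

  MinMax-intermediate : ∀ {l u v} → MinMax f l u → l ≤ v → v ≤ u → ∃ λ k → f k ≡ v
  MinMax-intermediate R l≤v v≤u with lower-attained R | upper-attained R
  ... | i , refl | j , refl = intermediate-value l≤v v≤u

AbCx-unique : ∀ {w n j j′} → AbCx w n j → AbCx w n j′ → j ≡ j′
AbCx-unique (L , L! , refl , L≈) (L′ , L′! , refl , L′≈) =
  ↭-length (∼bag⇒↭ (unique∧set⇒bag L! L′! (λ {p} → ⇔-trans (L≈ p) (⇔-sym (L′≈ p)))))

AbCx-MinMax : ∀ {w n l u} → MinMax (λ i → ones w i n) l u → AbCx w n (suc (u ∸ l))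
AbCx-MinMax {w} {n} {l} {u} R =
  applyUpTo vector k , applyUpTo⁺₁ vector k distinct , length-applyUpTo vector k ,
  λ p → mk⇔ (realised p) (listed p)
  where
  k = suc (u ∸ l)
  vector : ℕ → ℕ × ℕ
  vector d = n ∸ (l + d) , l + d
  distinct : ∀ {d e} → d < e → e < k → vector d ≢ vector e
  distinct d<e _ eq = <⇒≢ (+-monoʳ-< l d<e) (cong proj₂ eq)
  realised : ∀ p → p ∈ applyUpTo vector k → ∃ λ i → parikh w i n ≡ p
  realised p p∈ with ∈-applyUpTo⁻ vector p∈
  ... | d , s≤s d≤u∸l , refl
    with MinMax-intermediate (λ i → ones-suc-start≤ w i n) (λ i → ones≤suc-start w i n) R (m≤m+n l d)
           (subst (l + d ≤_) (m+[n∸m]≡n (MinMax-lower≤upper R)) (+-monoʳ-≤ l d≤u∸l))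
  ... | i , ones≡l+d = i , trans (parikh≡ w i n) (cong (λ v → n ∸ v , v) ones≡l+d)
  listed : ∀ p → (∃ λ i → parikh w i n ≡ p) → p ∈ applyUpTo vector k
  listed p (i , refl) = subst (_∈ applyUpTo vector k)
    (trans (cong (λ v → n ∸ v , v) (m+[n∸m]≡n (lower R i))) (sym (parikh≡ w i n)))
    (∈-applyUpTo⁺ vector (s≤s (∸-monoˡ-≤ l (upper R i))))


-- Extreme counts of ones in factors of S

bit-S-double : ∀ j → bit (S (double j)) ≡ 0
bit-S-double j = cong bit (S-double j)

bit-S-suc-double : ∀ j → bit (S (suc (double j))) + bit (S j) ≡ 1
bit-S-suc-double j = trans (cong (λ x → bit x + bit (S j)) (S-suc-double j)) (bit-complement (S j))

ones-S-double-start : ∀ i m → ones S (double i) m + ones S i ⌊ m /2⌋ ≡ ⌊ m /2⌋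
ones-S-double-start i zero = refl
ones-S-double-start i (suc zero) = cong (λ b → b + 0 + 0) (bit-S-double i)
ones-S-double-start i (suc (suc m)) = begin
  bit (S (double i)) + (b + x) + (c + y)   ≡⟨ cong (λ z → z + (b + x) + (c + y)) (bit-S-double i) ⟩
  (b + x) + (c + y)                        ≡⟨ interchange b x c y ⟩
  (b + c) + (x + y)                        ≡⟨ cong₂ _+_ (bit-S-suc-double i) (ones-S-double-start (suc i) m) ⟩
  suc ⌊ m /2⌋                              ∎
  where
  open ≡-Reasoning
  b = bit (S (suc (double i)))
  c = bit (S i)
  x = ones S (double (suc i)) m
  y = ones S (suc i) ⌊ m /2⌋

ones-S-suc-double-start : ∀ i m → ones S (suc (double i)) m + ones S i ⌈ m /2⌉ ≡ ⌈ m /2⌉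
ones-S-suc-double-start i zero = refl
ones-S-suc-double-start i (suc zero) = begin
  b + 0 + (c + 0)   ≡⟨ cong₂ _+_ (+-identityʳ b) (+-identityʳ c) ⟩
  b + c             ≡⟨ bit-S-suc-double i ⟩
  1                 ∎
  where
  open ≡-Reasoning
  b = bit (S (suc (double i)))
  c = bit (S i)
ones-S-suc-double-start i (suc (suc m)) = begin
  b + (bit (S (double (suc i))) + x) + (c + y)   ≡⟨ cong (λ z → b + (z + x) + (c + y)) (bit-S-double (suc i)) ⟩
  (b + x) + (c + y)                              ≡⟨ interchange b x c y ⟩
  (b + c) + (x + y)                              ≡⟨ cong₂ _+_ (bit-S-suc-double i) (ones-S-suc-double-start (suc i) m) ⟩
  suc ⌈ m /2⌉                                    ∎
  where
  open ≡-Reasoning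
  b = bit (S (suc (double i)))
  c = bit (S i)
  x = ones S (suc (double (suc i))) m
  y = ones S (suc i) ⌈ m /2⌉

onesS : ℕ → ℕ → ℕ
onesS n i = ones S i n

MinMax-onesS-0 : MinMax (onesS 0) 0 0
MinMax-onesS-0 = record { lower = λ _ → z≤n ; upper = λ _ → z≤n ; lower-attained = 0 , refl ; upper-attained = 0 , refl }

MinMax-onesS-1 : MinMax (onesS 1) 0 1
MinMax-onesS-1 = record
  { lower = λ _ → z≤n
  ; upper = λ i → ≤-trans (≤-reflexive (+-identityʳ _)) (bit≤1 (S i))
  ; lower-attained = 0 , refl
  ; upper-attained = 1 , refl
  }

MinMax-onesS-adjacent : ∀ {k k′ l u l′ u′} → k′ ≡ k ⊎ k′ ≡ suc k →
                       MinMax (onesS k) l u → MinMax (onesS k′) l′ u′ → k ∸ u ≤ k′ ∸ u′ × k ∸ l ≤ k′ ∸ l′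
MinMax-onesS-adjacent (inj₁ refl) R R′ with MinMax-unique R R′
... | refl , refl = ≤-refl , ≤-refl
MinMax-onesS-adjacent {k} (inj₂ refl) R R′ =
  let l′≤1+l , u′≤1+u = MinMax-≤-+ 1 (λ i → ones-suc-length≤ S i k) R R′
  in ∸-monoʳ-≤ (suc k) u′≤1+u , ∸-monoʳ-≤ (suc k) l′≤1+l

MinMax-onesS-halves : ∀ m {l u l′ u′} → MinMax (onesS ⌊ m /2⌋) l u → MinMax (onesS ⌈ m /2⌉) l′ u′ →
                      MinMax (onesS m) (⌊ m /2⌋ ∸ u) (⌈ m /2⌉ ∸ l′)
MinMax-onesS-halves m {l} {u} {l′} {u′} R R′ =
  let lower-ordered , upper-ordered = MinMax-onesS-adjacent (⌈n/2⌉≡⌊n/2⌋∨1+⌊n/2⌋ m) R R′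
  in MinMax-interleave evens odds lower-ordered upper-ordered
  where
  evens : MinMax (λ i → onesS m (double i)) (⌊ m /2⌋ ∸ u) (⌊ m /2⌋ ∸ l)
  evens = MinMax-cong (λ i → sym (m+n≡o⇒m≡o∸n (ones-S-double-start i m))) (MinMax-∸ ⌊ m /2⌋ R)
  odds : MinMax (λ i → onesS m (suc (double i))) (⌈ m /2⌉ ∸ u′) (⌈ m /2⌉ ∸ l′)
  odds = MinMax-cong (λ i → sym (m+n≡o⇒m≡o∸n (ones-S-suc-double-start i m))) (MinMax-∸ ⌈ m /2⌉ R′)

-- Opaque: unfolding the well-founded recursion defeats unification and termination checking.
opaque
  minMax : ∀ n → ∃₂ λ l u → MinMax (onesS n) l u
  minMax = <-rec _ go
    where
    go : ∀ n → (∀ {m} → m < n → ∃₂ λ l u → MinMax (onesS m) l u) → ∃₂ λ l u → MinMax (onesS n) l u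
    go zero _ = 0 , 0 , MinMax-onesS-0
    go (suc zero) _ = 0 , 1 , MinMax-onesS-1
    go (suc (suc n)) rec with rec (⌊n/2⌋<n (suc n)) | rec (⌈n/2⌉<n n)
    ... | _ , _ , R | _ , _ , R′ = _ , _ , MinMax-onesS-halves (suc (suc n)) R R′

lo hi : ℕ → ℕ
lo n = proj₁ (minMax n)
hi n = proj₁ (proj₂ (minMax n))

MinMax-lo-hi : ∀ n → MinMax (onesS n) (lo n) (hi n)
MinMax-lo-hi n = proj₂ (proj₂ (minMax n))

lo-hi-halves : ∀ m → lo m ≡ ⌊ m /2⌋ ∸ hi ⌊ m /2⌋ × hi m ≡ ⌈ m /2⌉ ∸ lo ⌈ m /2⌉
lo-hi-halves m = MinMax-unique (MinMax-lo-hi m) (MinMax-onesS-halves m (MinMax-lo-hi ⌊ m /2⌋) (MinMax-lo-hi ⌈ m /2⌉))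


-- Width of the range of counts

width : ℕ → ℕ
width n = hi n ∸ lo n

lo≤hi : ∀ n → lo n ≤ hi n
lo≤hi n = MinMax-lower≤upper (MinMax-lo-hi n)

hi≤length : ∀ n → hi n ≤ n
hi≤length n = let j , eq = upper-attained (MinMax-lo-hi n) in subst (_≤ n) eq (ones≤length S j n)

lo≤length : ∀ n → lo n ≤ n
lo≤length n = ≤-trans (lo≤hi n) (hi≤length n)

width≤length : ∀ n → width n ≤ n
width≤length n = ≤-trans (m∸n≤m (hi n) (lo n)) (hi≤length n)

lo-double : ∀ n → lo (double n) ≡ n ∸ hi n
lo-double n = trans (proj₁ (lo-hi-halves (double n))) (cong (λ k → k ∸ hi k) (⌊double[n]/2⌋≡n n))

hi-double : ∀ n → hi (double n) ≡ n ∸ lo n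
hi-double n = trans (proj₂ (lo-hi-halves (double n))) (cong (λ k → k ∸ lo k) (⌈double[n]/2⌉≡n n))

lo-suc-double : ∀ n → lo (suc (double n)) ≡ n ∸ hi n
lo-suc-double n = trans (proj₁ (lo-hi-halves (suc (double n)))) (cong (λ k → k ∸ hi k) (⌈double[n]/2⌉≡n n))

hi-suc-double : ∀ n → hi (suc (double n)) ≡ suc n ∸ lo (suc n)
hi-suc-double n = trans (proj₂ (lo-hi-halves (suc (double n)))) (cong (λ k → k ∸ lo k) (cong suc (⌊double[n]/2⌋≡n n)))

lo≤lo-suc : ∀ n → lo n ≤ lo (suc n)
lo≤lo-suc n = proj₁ (MinMax-≤-+ 0 (λ i → ones-mono-length S i n) (MinMax-lo-hi (suc n)) (MinMax-lo-hi n))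

lo-suc≤suc-lo : ∀ n → lo (suc n) ≤ suc (lo n)
lo-suc≤suc-lo n = proj₁ (MinMax-≤-+ 1 (λ i → ones-suc-length≤ S i n) (MinMax-lo-hi n) (MinMax-lo-hi (suc n)))

lo-suc : ∀ n → lo (suc n) ≡ lo n ⊎ lo (suc n) ≡ suc (lo n)
lo-suc n with m≤n⇒m<n∨m≡n (lo≤lo-suc n)
... | inj₁ lo<lo-suc = inj₂ (≤-antisym (lo-suc≤suc-lo n) lo<lo-suc)
... | inj₂ lo≡lo-suc = inj₁ (sym lo≡lo-suc)

width≡[n∸lo]∸[n∸hi] : ∀ n → width n ≡ (n ∸ lo n) ∸ (n ∸ hi n)
width≡[n∸lo]∸[n∸hi] n = sym ([m∸a]∸[m∸b]≡b∸a (lo≤hi n) (hi≤length n))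

width-double : ∀ n → width (double n) ≡ width n
width-double n = trans (cong₂ _∸_ (hi-double n) (lo-double n)) (sym (width≡[n∸lo]∸[n∸hi] n))

width-suc-double-stay : ∀ n → lo (suc n) ≡ lo n → width (suc (double n)) ≡ suc (width n)
width-suc-double-stay n lo-stays = begin
  width (suc (double n))           ≡⟨ cong₂ _∸_ (hi-suc-double n) (lo-suc-double n) ⟩
  (suc n ∸ lo (suc n)) ∸ (n ∸ hi n)   ≡⟨ cong (λ k → (suc n ∸ k) ∸ (n ∸ hi n)) lo-stays ⟩
  (suc n ∸ lo n) ∸ (n ∸ hi n)         ≡⟨ cong (_∸ (n ∸ hi n)) (+-∸-assoc 1 (lo≤length n)) ⟩
  suc (n ∸ lo n) ∸ (n ∸ hi n)         ≡⟨ +-∸-assoc 1 (∸-monoʳ-≤ n (lo≤hi n)) ⟩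
  suc ((n ∸ lo n) ∸ (n ∸ hi n))       ≡⟨ cong suc (width≡[n∸lo]∸[n∸hi] n) ⟨
  suc (width n)                       ∎
  where open ≡-Reasoning

width-suc-double-step : ∀ n → lo (suc n) ≡ suc (lo n) → width (suc (double n)) ≡ width n
width-suc-double-step n lo-steps = begin
  width (suc (double n))             ≡⟨ cong₂ _∸_ (hi-suc-double n) (lo-suc-double n) ⟩
  (suc n ∸ lo (suc n)) ∸ (n ∸ hi n)   ≡⟨ cong (λ k → (suc n ∸ k) ∸ (n ∸ hi n)) lo-steps ⟩
  (n ∸ lo n) ∸ (n ∸ hi n)             ≡⟨ width≡[n∸lo]∸[n∸hi] n ⟨
  width n                             ∎
  where open ≡-Reasoning

width≤width-suc-double : ∀ n → width n ≤ width (suc (double n))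
width≤width-suc-double n with lo-suc n
... | inj₁ lo-stays = ≤-trans (n≤1+n (width n)) (≤-reflexive (sym (width-suc-double-stay n lo-stays)))
... | inj₂ lo-steps = ≤-reflexive (sym (width-suc-double-step n lo-steps))

width-suc-double≤ : ∀ n → width (suc (double n)) ≤ suc (width n)
width-suc-double≤ n with lo-suc n
... | inj₁ lo-stays = ≤-reflexive (width-suc-double-stay n lo-stays)
... | inj₂ lo-steps = ≤-trans (≤-reflexive (width-suc-double-step n lo-steps)) (n≤1+n (width n))

width-one : width 1 ≡ 1
width-one with MinMax-unique (MinMax-lo-hi 1) MinMax-onesS-1
... | lo≡0 , hi≡1 = cong₂ _∸_ hi≡1 lo≡0

width-2^ : ∀ k → width (2 ^ k) ≡ 1
width-2^ zero = width-one
width-2^ (suc k) = trans (cong width (2^suc≡double k)) (trans (width-double (2 ^ k)) (width-2^ k))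

width-positive : ∀ n → 1 ≤ n → 1 ≤ width n
width-positive = <-rec (λ n → 1 ≤ n → 1 ≤ width n) go
  where
  go : ∀ n → (∀ {m} → m < n → 1 ≤ m → 1 ≤ width m) → 1 ≤ n → 1 ≤ width n
  go n rec 1≤n with halving n
  go _ rec () | even zero
  go _ rec _ | even (suc m) =
    subst (1 ≤_) (sym (width-double (suc m))) (rec (s≤s (s≤s (n≤double m))) (s≤s z≤n))
  go _ rec _ | odd zero = ≤-reflexive (sym width-one)
  go _ rec _ | odd (suc m) =
    ≤-trans (rec (s≤s (s≤s (≤-trans (n≤double m) (n≤1+n _)))) (s≤s z≤n)) (width≤width-suc-double (suc m))

n<2^L⇒width≤L : ∀ L n → n < 2 ^ L → width n ≤ L
n<2^L⇒width≤L zero n (s≤s z≤n) = width≤length 0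
n<2^L⇒width≤L (suc L) n n<2^L+1 with halving n | subst (n <_) (2^suc≡double L) n<2^L+1
... | even m | 2m<2^L+1 = begin
  width (double m)   ≡⟨ width-double m ⟩
  width m            ≤⟨ n<2^L⇒width≤L L m (double-cancel-< 2m<2^L+1) ⟩
  L                  ≤⟨ n≤1+n L ⟩
  suc L              ∎
  where open ≤-Reasoning
... | odd m | 2m+1<2^L+1 = begin
  width (suc (double m))   ≤⟨ width-suc-double≤ m ⟩
  suc (width m)            ≤⟨ s≤s (n<2^L⇒width≤L L m (double-cancel-< (<-trans (n<1+n _) 2m+1<2^L+1))) ⟩
  suc L                    ∎
  where open ≤-Reasoning

-- repunit k = (4^k − 1)/3, with binary expansion 0101…01.
repunit : ℕ → ℕ
repunit zero = 0
repunit (suc k) = suc (double (double (repunit k)))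

width-repunit : ∀ k → width (repunit k) ≡ k
width-repunit zero = n≤0⇒n≡0 (width≤length 0)
width-repunit (suc k) = begin
  width (suc (double (double r)))   ≡⟨ width-suc-double-stay (double r) lo-stays ⟩
  suc (width (double r))            ≡⟨ cong suc (width-double r) ⟩
  suc (width r)                     ≡⟨ cong suc (width-repunit k) ⟩
  suc k                             ∎
  where
  open ≡-Reasoning
  r = repunit k
  lo-stays : lo (suc (double r)) ≡ lo (double r)
  lo-stays = trans (lo-suc-double r) (sym (lo-double r))

repunit<4^ : ∀ k → repunit k < 4 ^ k
repunit<4^ zero = s≤s z≤n
repunit<4^ (suc k) = begin-strict
  suc (double (double r))   <⟨ s≤s (s≤s (m≤n+m _ 2)) ⟩
  double (double (suc r))   ≡⟨ double-double≡4* (suc r) ⟩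
  4 * suc r                 ≤⟨ *-monoʳ-≤ 4 (repunit<4^ k) ⟩
  4 * 4 ^ k                 ∎
  where
  open ≤-Reasoning
  r = repunit k
  double-double≡4* : ∀ n → double (double n) ≡ 4 * n
  double-double≡4* n = trans (double≡2* (double n)) (trans (cong (2 *_) (double≡2* n)) (sym (*-assoc 2 2 n)))

repunit-increasing : ∀ k → repunit k < repunit (suc k)
repunit-increasing k = s≤s (≤-trans (n≤double _) (n≤double _))


-- Abelian complexities of S

abelianComplexity : ∀ n → AbCx S n (suc (width n))
abelianComplexity n = AbCx-MinMax {S} {n} (MinMax-lo-hi n)

AbCx-S-width : ∀ n {j} → AbCx S n j → j ≡ suc (width n)
AbCx-S-width n A = AbCx-unique {S} {n} A (abelianComplexity n)

maxWidth : ℕ → ℕ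
maxWidth zero = 0
maxWidth (suc n) = maxWidth n ⊔ width (suc n)

width≤maxWidth : ∀ {m n} → m ≤ n → width m ≤ maxWidth n
width≤maxWidth {n = zero} z≤n = width≤length 0
width≤maxWidth {m} {suc n} m≤n+1 with m≤n⇒m<n∨m≡n m≤n+1
... | inj₁ (s≤s m≤n) = ≤-trans (width≤maxWidth m≤n) (m≤m⊔n (maxWidth n) _)
... | inj₂ refl = m≤n⊔m (maxWidth n) _

maxWidth-attained : ∀ n → 1 ≤ n → ∃ λ m → 1 ≤ m × m ≤ n × maxWidth n ≡ width m
maxWidth-attained (suc zero) _ = 1 , ≤-refl , ≤-refl , refl
maxWidth-attained (suc (suc n)) _
  with maxWidth-attained (suc n) (s≤s z≤n) | ⊔-sel (maxWidth (suc n)) (width (suc (suc n)))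
... | m , 1≤m , m≤n+1 , eq′ | inj₁ eq = m , 1≤m , ≤-trans m≤n+1 (n≤1+n _) , trans eq eq′
... | _ | inj₂ eq = suc (suc n) , s≤s z≤n , ≤-refl , eq

upperAbCx : ∀ n → 1 ≤ n → UpperAbCx S n (suc (maxWidth n))
upperAbCx n 1≤n =
  (λ m j _ m≤n A → subst (_≤ suc (maxWidth n)) (sym (AbCx-S-width m A)) (s≤s (width≤maxWidth m≤n))) ,
  (let m , 1≤m , m≤n , eq = maxWidth-attained n 1≤n
   in m , 1≤m , m≤n , subst (AbCx S m) (cong suc (sym eq)) (abelianComplexity m))

lowerAbCx : ∀ n → 1 ≤ n → LowerAbCx S n 2
lowerAbCx n 1≤n =
  (λ m j n≤m A → subst (2 ≤_) (sym (AbCx-S-width m A)) (s≤s (width-positive m (≤-trans 1≤n n≤m)))) ,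
  (2 ^ n , <⇒≤ (n<2^n n) , subst (λ w → AbCx S (2 ^ n) (suc w)) (width-2^ n) (abelianComplexity (2 ^ n)))

maxWidth≤suc-⌊log₂⌋ : ∀ n → 1 ≤ n → maxWidth n ≤ suc ⌊log₂ n ⌋
maxWidth≤suc-⌊log₂⌋ n 1≤n with maxWidth-attained n 1≤n
... | m , _ , m≤n , eq = begin
  maxWidth n        ≡⟨ eq ⟩
  width m           ≤⟨ n<2^L⇒width≤L (suc ⌊log₂ m ⌋) m (n<2^suc⌊log₂n⌋ m) ⟩
  suc ⌊log₂ m ⌋     ≤⟨ s≤s (⌊log₂⌋-mono-≤ m≤n) ⟩
  suc ⌊log₂ n ⌋     ∎
  where open ≤-Reasoning

⌊log₂⌋≤2*suc-maxWidth : ∀ n → ⌊log₂ n ⌋ ≤ 2 * suc (maxWidth n)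
⌊log₂⌋≤2*suc-maxWidth n with bracket refl repunit-increasing n
... | k , rk≤n , n<rk+1 = begin
  ⌊log₂ n ⌋               ≤⟨ n≤2^k⇒⌊log₂n⌋≤k (<⇒≤ (<-trans n<rk+1 rk+1<2^)) ⟩
  2 * suc k               ≤⟨ *-monoʳ-≤ 2 (s≤s k≤maxWidth) ⟩
  2 * suc (maxWidth n)    ∎
  where
  open ≤-Reasoning
  rk+1<2^ : repunit (suc k) < 2 ^ (2 * suc k)
  rk+1<2^ = subst (repunit (suc k) <_) (^-*-assoc 2 2 (suc k)) (repunit<4^ (suc k))
  k≤maxWidth : k ≤ maxWidth n
  k≤maxWidth = subst (_≤ maxWidth n) (width-repunit k) (width≤maxWidth rk≤n)

suc-maxWidth≍⌊log₂⌋ : ∀ n → 2 ≤ n → ⌊log₂ n ⌋ ≤ 2 * suc (maxWidth n) × suc (maxWidth n) ≤ 3 * ⌊log₂ n ⌋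
suc-maxWidth≍⌊log₂⌋ n 2≤n =
  ⌊log₂⌋≤2*suc-maxWidth n , ≤-trans (s≤s (maxWidth≤suc-⌊log₂⌋ n (<⇒≤ 2≤n))) (2+n≤3*n 1≤⌊log₂n⌋)
  where
  1≤⌊log₂n⌋ : 1 ≤ ⌊log₂ n ⌋
  1≤⌊log₂n⌋ = 2^k≤n⇒k≤⌊log₂n⌋ 2≤n

theorem3 : (∃ λ a → ∃ λ b → ∃ λ N → ∀ n → N ≤ n →
             ∃ λ k → UpperAbCx S n k × ⌊log₂ n ⌋ ≤ a * k × k ≤ b * ⌊log₂ n ⌋)
           × (∀ n → 1 ≤ n → LowerAbCx S n 2)
theorem3 =
  (2 , 3 , 2 , λ n 2≤n → suc (maxWidth n) , upperAbCx n (<⇒≤ 2≤n) , suc-maxWidth≍⌊log₂⌋ n 2≤n) ,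
  lowerAbCx
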